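{- Let $r_n=a_{n,n}$ for $n\ge0$, and set $r_n=0$ for $n<0$. Then for every integer $n\ge1$, $$n r_n-(2n-1)r_{n-1}-(n-1)r_{n-2}-(2n-3)r_{n-3}+(n-2)r_{n-4}=0.$$
   Context: For nonnegative integers $p,q$, $a_{p,q}$ is the number of ways to partition a set consisting of $p$ marked points on a line and $q$ marked points on a parallel line into pairs, joining the two points of each pair by a straight segment, such that no two segments have a common point (in particular, no endpoint lies on another segment). We have $a_{0,0}=1$. -}

module Defs where

open import Data.Bool using (Bool; true; false; _∧_; _∨_; not; if_then_else_)
open import Data.Nat using (ℕ; zero; suc; _≤ᵇ_; _+_)
open import Data.List using (List; []; _∷_; _++_; map; concatMap; filter; length; upTo)
open import Data.Product using (_×_; _,_)
open import Data.Integer as ℤ using (ℤ; +_; -[1+_])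
open import Relation.Nullary.Decidable using (does)
open import Data.Bool.Properties using (T?)

-- A marked point: (line, position).  Line true = first ("upper") line,
-- line false = second parallel line.  Position i means the (i+1)-th marked
-- point from the left on that line (only the left-to-right order of the
-- points matters for which straight segments meet).
Point : Set
Point = Bool × ℕ

Seg : Set
Seg = Point × Point

pointsOn : Bool → ℕ → List Point
pointsOn l k = map (λ i → (l , i)) (upTo k)

points : ℕ → ℕ → List Point
points p q = pointsOn true p ++ pointsOn false q

picks : {A : Set} → List A → List (A × List A)
picks [] = []
picks (x ∷ xs) = (x , xs) ∷ map (λ { (y , ys) → (y , x ∷ ys) }) (picks xs)

-- all partitions of a list into pairs (perfect matchings); fuel ≥ length
pairingsF : {A : Set} → ℕ → List A → List (List (A × A))
pairingsF _ [] = [] ∷ []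
pairingsF zero (_ ∷ _) = []
pairingsF (suc n) (x ∷ xs) =
  concatMap (λ { (y , ys) → map ((x , y) ∷_) (pairingsF n ys) }) (picks xs)

pairings : {A : Set} → List A → List (List (A × A))
pairings xs = pairingsF (length xs) xs

_==ᵇ_ : Bool → Bool → Bool
true ==ᵇ b = b
false ==ᵇ b = not b

between : ℕ → ℕ → ℕ → Bool
between a b j = ((a ≤ᵇ j) ∧ (j ≤ᵇ b)) ∨ ((b ≤ᵇ j) ∧ (j ≤ᵇ a))

segOverlap : ℕ → ℕ → ℕ → ℕ → Bool
segOverlap a b c d = between a b c ∨ between a b d ∨ between c d a ∨ between c d b

-- does the straight segment joining two points on the same line l,
-- at positions a and b, meet the straight segment joining
-- point (true , i) to point (false , k) ?  The crossing segment meets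
-- line l only in its endpoint on l.
sameCross : Bool → ℕ → ℕ → ℕ → ℕ → Bool
sameCross true a b i k = between a b i
sameCross false a b i k = between a b k

crossCross : ℕ → ℕ → ℕ → ℕ → Bool
crossCross u w u' w' = ((u ≤ᵇ u') ∧ (w' ≤ᵇ w)) ∨ ((u' ≤ᵇ u) ∧ (w ≤ᵇ w'))

meets : Seg → Seg → Bool
meets ((l₁ , a) , (l₂ , b)) ((l₃ , c) , (l₄ , d)) = go l₁ l₂ l₃ l₄
  where
  go : Bool → Bool → Bool → Bool → Bool
  go true  true  true  true  = segOverlap a b c d
  go false false false false = segOverlap a b c d
  go true  true  false false = false
  go false false true  true  = false
  go true  true  true  false = sameCross true a b c d
  go true  true  false true  = sameCross true a b d c
  go false false true  false = sameCross false a b c d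
  go false false false true  = sameCross false a b d c
  go true  false true  true  = sameCross true c d a b
  go false true  true  true  = sameCross true c d b a
  go true  false false false = sameCross false c d a b
  go false true  false false = sameCross false c d b a
  -- both crossing: upper positions u,u', lower positions w,w'
  go true  false true  false = crossCross a b c d
  go true  false false true  = crossCross a b d c
  go false true  true  false = crossCross b a c d
  go false true  false true  = crossCross b a d c

disjointAll : List Seg → Bool
disjointAll [] = true
disjointAll (s ∷ ss) = noneMeet ss ∧ disjointAll ss
  where
  noneMeet : List Seg → Bool
  noneMeet [] = true
  noneMeet (t ∷ ts) = not (meets s t) ∧ noneMeet ts

a : ℕ → ℕ → ℕ
a p q = length (filter (λ m → T? (disjointAll m)) (pairings (points p q)))

r : ℤ → ℤ
r (+ n) = + a n n
r -[1+ _ ] = + 0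

-- A segment with a further marked point on it can never be used, so in a valid partition the segments
-- within a line join neighbours, and the crossing segments join the upper and lower points they use in
-- left-to-right order. Hence the first upper point is joined either to its neighbour or to a lower point
-- preceded by an even number of unused lower points, which must be tiled by neighbour pairs; this gives
-- a p q = matchings p q, where matchings (m + 2) n = matchings m n + Σⱼ matchings (m + 1) (n - 1 - 2j).
-- Equivalently F = Σ a p q xᵖ yᑫ satisfies D F = 1 for D = (1 - x²)(1 - y²) - xy. From F = 1/D,
-- (y∂D/∂y)(x∂F/∂x) = (x∂D/∂x)(y∂F/∂y); coefficientwise, multiplying this identity by D turns it into
-- coefficients of D F - 1 times coordinates, and D is invertible on series supported in the quadrant.
-- Twice the diagonal recurrence is a combination of these two identities.
module Submission where

open import Defs

module Matchings where

  open import Data.Bool using (Bool; true; false; _∧_; _∨_; not; if_then_else_; T)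
  open import Data.Bool.Properties using (T?; ∧-zeroʳ; ∧-identityʳ; ∨-zeroʳ) renaming (_≟_ to _≟ᵇ_)
  open import Data.Nat using (ℕ; zero; suc; _+_; _*_; _≤_; _<_; _≤ᵇ_; s≤s; z≤n)
  import Data.Nat.Properties as ℕ
  open import Data.List using (List; []; _∷_; _++_; map; concatMap; filter; length; applyUpTo)
  open import Data.Bool.ListAction using (all)
  import Data.List.Properties as List
  open import Data.List.Membership.Propositional using (_∈_)
  open import Data.List.Membership.Propositional.Properties using (∈-map⁻; ∈-map⁺; ∈-++⁻; ∈-++⁺ˡ; ∈-++⁺ʳ)
  open import Data.List.Relation.Unary.All as All using (All; []; _∷_)
  open import Data.List.Relation.Unary.AllPairs as AllPairs using (AllPairs; []; _∷_)
  import Data.List.Relation.Unary.All.Properties as All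
  import Data.List.Relation.Unary.AllPairs.Properties as AllPairs
  open import Data.List.Relation.Binary.Subset.Propositional using (_⊆_)
  open import Data.List.Relation.Binary.Subset.Propositional.Properties using (⊆-refl; ∷⁺ʳ)
  open import Data.List.Relation.Unary.Any using (here; there)
  open import Data.Product using (_×_; _,_; Σ; proj₁; proj₂)
  open import Data.Unit using (⊤)
  open import Data.Nat.Tactic.RingSolver using (solve-∀)
  open import Data.Product.Properties using (≡-dec)
  open import Data.Sum using (_⊎_; inj₁; inj₂)
  open import Data.Empty using (⊥-elim)
  open import Relation.Nullary using (yes; no; Dec)
  open import Relation.Binary.PropositionalEquality

  tilings : ℕ → ℕ
  tilings zero = 1
  tilings (suc zero) = 0
  tilings (suc (suc n)) = tilings n

  sumEveryOther : (ℕ → ℕ) → ℕ → ℕ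
  sumEveryOther f zero = 0
  sumEveryOther f (suc zero) = f 0
  sumEveryOther f (suc (suc n)) = f (suc n) + sumEveryOther f n

  matchings : ℕ → ℕ → ℕ
  matchings zero n = tilings n
  matchings (suc zero) n = sumEveryOther (matchings 0) n
  matchings (suc (suc m)) n = matchings m n + sumEveryOther (matchings (suc m)) n

  countᵇ : {X : Set} → (X → Bool) → List X → ℕ
  countᵇ g [] = 0
  countᵇ g (x ∷ xs) = (if g x then 1 else 0) + countᵇ g xs

  length-filter-T? : ∀ {X : Set} (g : X → Bool) xs → length (filter (λ x → T? (g x)) xs) ≡ countᵇ g xs
  length-filter-T? g [] = refl
  length-filter-T? g (x ∷ xs) with g x
  ... | true = cong suc (length-filter-T? g xs)
  ... | false = length-filter-T? g xs

  countᵇ-++ : ∀ {X : Set} (g : X → Bool) xs ys → countᵇ g (xs ++ ys) ≡ countᵇ g xs + countᵇ g ys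
  countᵇ-++ g [] ys = refl
  countᵇ-++ g (x ∷ xs) ys = trans (cong (_ +_) (countᵇ-++ g xs ys)) (sym (ℕ.+-assoc (if g x then 1 else 0) _ _))

  countᵇ-map : ∀ {X Y : Set} (g : X → Bool) (k : Y → X) l → countᵇ g (map k l) ≡ countᵇ (λ y → g (k y)) l
  countᵇ-map g k [] = refl
  countᵇ-map g k (y ∷ l) = cong (_ +_) (countᵇ-map g k l)

  countᵇ-cong : ∀ {X : Set} {g g′ : X → Bool} → (∀ x → g x ≡ g′ x) → ∀ l → countᵇ g l ≡ countᵇ g′ l
  countᵇ-cong e [] = refl
  countᵇ-cong e (x ∷ l) = cong₂ (λ b n → (if b then 1 else 0) + n) (e x) (countᵇ-cong e l)

  countᵇ-∧ : ∀ {X : Set} b (g : X → Bool) l → countᵇ (λ x → b ∧ g x) l ≡ (if b then countᵇ g l else 0)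
  countᵇ-∧ true g l = refl
  countᵇ-∧ false g [] = refl
  countᵇ-∧ false g (x ∷ l) = countᵇ-∧ false g l

  sumPicks : {X : Set} → (X → List X → ℕ) → List X → ℕ
  sumPicks g [] = 0
  sumPicks g (x ∷ xs) = g x xs + sumPicks (λ y ys → g y (x ∷ ys)) xs

  countᵇ-concatMap-picks : ∀ {X Y : Set} (g : Y → Bool) (h : X × List X → List Y) xs →
    countᵇ g (concatMap h (picks xs)) ≡ sumPicks (λ y ys → countᵇ g (h (y , ys))) xs
  countᵇ-concatMap-picks g h [] = refl
  countᵇ-concatMap-picks g h (x ∷ xs) = begin
    countᵇ g (h (x , xs) ++ concatMap h (map _ (picks xs)))
      ≡⟨ countᵇ-++ g (h (x , xs)) _ ⟩
    countᵇ g (h (x , xs)) + countᵇ g (concatMap h (map _ (picks xs)))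
      ≡⟨ cong (λ l → _ + countᵇ g l) (List.concatMap-map h _ (picks xs)) ⟩
    countᵇ g (h (x , xs)) + countᵇ g (concatMap _ (picks xs))
      ≡⟨ cong (_ +_) (countᵇ-concatMap-picks g _ xs) ⟩
    sumPicks (λ y ys → countᵇ g (h (y , ys))) (x ∷ xs) ∎
    where open ≡-Reasoning

  sumPicks-cong : ∀ {X : Set} {g g′ : X → List X → ℕ} → (∀ y ys → g y ys ≡ g′ y ys) → ∀ xs → sumPicks g xs ≡ sumPicks g′ xs
  sumPicks-cong e [] = refl
  sumPicks-cong e (x ∷ xs) = cong₂ _+_ (e x xs) (sumPicks-cong (λ y ys → e y (x ∷ ys)) xs)

  sumPicks-++ : ∀ {X : Set} (g : X → List X → ℕ) xs ys →
    sumPicks g (xs ++ ys) ≡ sumPicks (λ y r → g y (r ++ ys)) xs + sumPicks (λ y r → g y (xs ++ r)) ys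
  sumPicks-++ g [] ys = refl
  sumPicks-++ g (x ∷ xs) ys = trans (cong (g x (xs ++ ys) +_) (sumPicks-++ (λ y r → g y (x ∷ r)) xs ys))
    (sym (ℕ.+-assoc (g x (xs ++ ys)) _ _))

  Pick : {X : Set} → List X → X → List X → Set
  Pick xs y ys = y ∈ xs × xs ⊆ y ∷ ys × ys ⊆ xs

  sumPicks-cong-Pick : ∀ {X : Set} {g g′ : X → List X → ℕ} xs →
    (∀ y ys → Pick xs y ys → g y ys ≡ g′ y ys) → sumPicks g xs ≡ sumPicks g′ xs
  sumPicks-cong-Pick [] e = refl
  sumPicks-cong-Pick (x ∷ xs) e =
    cong₂ _+_ (e x xs (here refl , ⊆-refl , there)) (sumPicks-cong-Pick xs (λ y ys p → e y (x ∷ ys) (extend p)))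
    where
    extend : ∀ {y ys} → Pick xs y ys → Pick (x ∷ xs) y (x ∷ ys)
    extend (y∈ , cover , sub) = there y∈ , cover′ , ∷⁺ʳ x sub
      where
      cover′ : x ∷ xs ⊆ _ ∷ x ∷ _
      cover′ (here refl) = there (here refl)
      cover′ (there z∈) with cover z∈
      ... | here z≡y = here z≡y
      ... | there z∈ys = there (there z∈ys)

  sumPicks-zero : ∀ {X : Set} {g : X → List X → ℕ} xs → (∀ y ys → Pick xs y ys → g y ys ≡ 0) → sumPicks g xs ≡ 0
  sumPicks-zero xs e = trans (sumPicks-cong-Pick xs e) (zeros xs)
    where
    zeros : ∀ {X : Set} (xs : List X) → sumPicks (λ _ _ → 0) xs ≡ 0
    zeros [] = refl
    zeros (x ∷ xs) = zeros xs

  if-zero : ∀ (b : Bool) {n} → n ≡ 0 → (if b then n else 0) ≡ 0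
  if-zero true e = e
  if-zero false e = refl

  if-false : ∀ {b : Bool} {n} → b ≡ false → (if b then n else 0) ≡ 0
  if-false refl = refl

  meetsNone : Seg → List Seg → Bool
  meetsNone s = all (λ t → not (meets s t))

  disjointAll-∷ : ∀ s ss → disjointAll (s ∷ ss) ≡ meetsNone s ss ∧ disjointAll ss
  disjointAll-∷ s [] = refl
  disjointAll-∷ s (t ∷ ts) = absorb (not (meets s t)) _ (meetsNone s ts) _ (disjointAll ts) (disjointAll-∷ s ts)
    where
    -- the helper noneMeet of disjointAll is local to it, so its agreement with meetsNone is only
    -- available in conjunction with disjointAll ts, and that suffices
    absorb : ∀ a I N J d → I ∧ d ≡ N ∧ d → (a ∧ I) ∧ (J ∧ d) ≡ (a ∧ N) ∧ (J ∧ d)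
    absorb a I N J false _ rewrite ∧-zeroʳ J | ∧-zeroʳ (a ∧ I) | ∧-zeroʳ (a ∧ N) = refl
    absorb a I N J true e rewrite ∧-identityʳ I | ∧-identityʳ N | e = refl

  admissible : (Seg → Bool) → List Seg → Bool
  admissible P M = all P M ∧ disjointAll M

  all-∧-not-meets : ∀ P s M → all (λ t → P t ∧ not (meets s t)) M ≡ all P M ∧ meetsNone s M
  all-∧-not-meets P s [] = refl
  all-∧-not-meets P s (t ∷ M) rewrite all-∧-not-meets P s M =
    interchange (P t) (not (meets s t)) (all P M) (meetsNone s M)
    where
    interchange : ∀ p q a b → (p ∧ q) ∧ (a ∧ b) ≡ (p ∧ a) ∧ (q ∧ b)
    interchange true true a b = refl
    interchange true false a b = sym (∧-zeroʳ a)
    interchange false q a b = refl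

  admissible-∷ : ∀ P s M → admissible P (s ∷ M) ≡ P s ∧ admissible (λ t → P t ∧ not (meets s t)) M
  admissible-∷ P s M rewrite disjointAll-∷ s M | all-∧-not-meets P s M =
    regroup (P s) (all P M) (meetsNone s M) (disjointAll M)
    where
    regroup : ∀ p a n d → (p ∧ a) ∧ (n ∧ d) ≡ p ∧ ((a ∧ n) ∧ d)
    regroup true true n d = refl
    regroup true false n d = refl
    regroup false a n d = refl

  -- Counts like pairingsF (f is fuel), keeping in P only the segments that are still usable.
  countMatchings : ℕ → List Point → (Seg → Bool) → ℕ
  countStartingWith : ℕ → (Seg → Bool) → Point → Point → List Point → ℕ

  countMatchings _ [] P = 1
  countMatchings zero (_ ∷ _) P = 0
  countMatchings (suc f) (x ∷ xs) P = sumPicks (countStartingWith f P x) xs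

  countStartingWith f P x y ys = if P (x , y) then countMatchings f ys (λ t → P t ∧ not (meets (x , y) t)) else 0

  countᵇ-pairingsF : ∀ f L P → countᵇ (admissible P) (pairingsF f L) ≡ countMatchings f L P
  countᵇ-pairingsF f [] P = refl
  countᵇ-pairingsF zero (x ∷ xs) P = refl
  countᵇ-pairingsF (suc f) (x ∷ xs) P =
    trans (countᵇ-concatMap-picks (admissible P) _ xs) (sumPicks-cong (λ y ys → begin
      countᵇ (admissible P) (map ((x , y) ∷_) (pairingsF f ys))
        ≡⟨ countᵇ-map (admissible P) ((x , y) ∷_) (pairingsF f ys) ⟩
      countᵇ (λ M → admissible P ((x , y) ∷ M)) (pairingsF f ys)
        ≡⟨ countᵇ-cong (admissible-∷ P (x , y)) (pairingsF f ys) ⟩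
      countᵇ (λ M → P (x , y) ∧ admissible (λ t → P t ∧ not (meets (x , y) t)) M) (pairingsF f ys)
        ≡⟨ countᵇ-∧ (P (x , y)) _ (pairingsF f ys) ⟩
      (if P (x , y) then countᵇ (admissible (λ t → P t ∧ not (meets (x , y) t))) (pairingsF f ys) else 0)
        ≡⟨ cong (λ n → if P (x , y) then n else 0) (countᵇ-pairingsF f ys _) ⟩
      (if P (x , y) then countMatchings f ys (λ t → P t ∧ not (meets (x , y) t)) else 0) ∎) xs)
    where open ≡-Reasoning

  inside : Seg → Point → Bool
  inside ((true , a) , (true , b)) (true , c) = between a b c
  inside ((false , a) , (false , b)) (false , c) = between a b c
  inside _ _ = false

  ∨-true : ∀ x {y} → y ≡ true → x ∨ y ≡ true
  ∨-true x refl = ∨-zeroʳ x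

  inside-meetsʳ : ∀ s z w → inside s z ≡ true → meets s (z , w) ≡ true × meets s (w , z) ≡ true
  inside-meetsʳ ((true , a) , (true , b)) (true , c) (true , d) h =
    cong (_∨ (between a b d ∨ between c d a ∨ between c d b)) h ,
    ∨-true (between a b d) (cong (_∨ (between d c a ∨ between d c b)) h)
  inside-meetsʳ ((true , a) , (true , b)) (true , c) (false , d) h = h , h
  inside-meetsʳ ((false , a) , (false , b)) (false , c) (false , d) h =
    cong (_∨ (between a b d ∨ between c d a ∨ between c d b)) h ,
    ∨-true (between a b d) (cong (_∨ (between d c a ∨ between d c b)) h)
  inside-meetsʳ ((false , a) , (false , b)) (false , c) (true , d) h = h , h
  inside-meetsʳ ((true , _) , (true , _)) (false , _) w ()
  inside-meetsʳ ((false , _) , (false , _)) (true , _) w ()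
  inside-meetsʳ ((true , _) , (false , _)) z w ()
  inside-meetsʳ ((false , _) , (true , _)) z w ()

  inside-meetsˡ : ∀ t z w → inside t z ≡ true → meets (z , w) t ≡ true × meets (w , z) t ≡ true
  inside-meetsˡ ((true , c) , (true , d)) (true , a) (true , b) h =
    ∨-true (between a b c) (∨-true (between a b d) (cong (_∨ between c d b) h)) ,
    ∨-true (between b a c) (∨-true (between b a d) (∨-true (between c d b) h))
  inside-meetsˡ ((true , c) , (true , d)) (true , a) (false , b) h = h , h
  inside-meetsˡ ((false , c) , (false , d)) (false , a) (false , b) h =
    ∨-true (between a b c) (∨-true (between a b d) (cong (_∨ between c d b) h)) ,
    ∨-true (between b a c) (∨-true (between b a d) (∨-true (between c d b) h))
  inside-meetsˡ ((false , c) , (false , d)) (false , a) (true , b) h = h , h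
  inside-meetsˡ ((true , _) , (true , _)) (false , _) w ()
  inside-meetsˡ ((false , _) , (false , _)) (true , _) w ()
  inside-meetsˡ ((true , _) , (false , _)) z w ()
  inside-meetsˡ ((false , _) , (true , _)) z w ()

  countMatchings-isolated : ∀ f L P {z} → z ∈ L →
    (∀ w → P (z , w) ≡ false) → (∀ w → P (w , z) ≡ false) → countMatchings f L P ≡ 0
  countMatchings-isolated zero (x ∷ xs) P z∈ from to = refl
  countMatchings-isolated (suc f) (x ∷ xs) P (here refl) from to = sumPicks-zero xs (λ y _ _ → if-false (from y))
  countMatchings-isolated (suc f) (x ∷ xs) P {z} (there z∈) from to = sumPicks-zero xs term
    where
    term : ∀ y ys → Pick xs y ys → _ ≡ 0
    term y ys (_ , cover , _) with cover z∈
    ... | here refl = if-false (to x)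
    ... | there z∈ys = if-zero (P (x , y))
      (countMatchings-isolated f ys _ z∈ys (λ w → cong (_∧ _) (from w)) (λ w → cong (_∧ _) (to w)))

  Hollow : List Point → Seg → Set
  Hollow L s = ∀ {z} → z ∈ L → z ≢ proj₁ s → z ≢ proj₂ s → inside s z ≡ false

  PointInside : List Point → Seg → Set
  PointInside L s = Σ Point λ z → z ∈ L × z ≢ proj₁ s × z ≢ proj₂ s × inside s z ≡ true

  _≟ᴾ_ : (u v : Point) → Dec (u ≡ v)
  _≟ᴾ_ = ≡-dec _≟ᵇ_ ℕ._≟_

  pointInside? : ∀ s L → PointInside L s ⊎ Hollow L s
  pointInside? s [] = inj₂ (λ ())
  pointInside? s (x ∷ L) with pointInside? s L
  ... | inj₁ (z , z∈ , z≢ , z≢′ , i) = inj₁ (z , there z∈ , z≢ , z≢′ , i)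
  ... | inj₂ hollow with x ≟ᴾ proj₁ s | x ≟ᴾ proj₂ s | inside s x in eq
  ...   | yes x≡ | _ | _ = inj₂ λ { (here refl) x≢ _ → ⊥-elim (x≢ x≡) ; (there z∈) → hollow z∈ }
  ...   | no _ | yes x≡ | _ = inj₂ λ { (here refl) _ x≢ → ⊥-elim (x≢ x≡) ; (there z∈) → hollow z∈ }
  ...   | no x≢ | no x≢′ | true = inj₁ (x , here refl , x≢ , x≢′ , eq)
  ...   | no _ | no _ | false = inj₂ λ { (here refl) _ _ → eq ; (there z∈) → hollow z∈ }

  -- A segment with a further marked point z on it can never be used, since the segment at z would
  -- meet it; so only the values of P on hollow segments matter.
  countMatchings-cong : ∀ f L {P P′} → (∀ {x y} → x ∈ L → y ∈ L → Hollow L (x , y) → P (x , y) ≡ P′ (x , y)) →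
    countMatchings f L P ≡ countMatchings f L P′
  countMatchings-cong f [] agree = refl
  countMatchings-cong zero (x ∷ xs) agree = refl
  countMatchings-cong (suc f) (x ∷ xs) {P} {P′} agree = sumPicks-cong-Pick xs term
    where
    term : ∀ y ys → Pick xs y ys → countStartingWith f P x y ys ≡ countStartingWith f P′ x y ys
    term y ys (y∈ , cover , sub) with pointInside? (x , y) (x ∷ xs)
    ... | inj₁ (z , here refl , z≢x , _) = ⊥-elim (z≢x refl)
    ... | inj₁ (z , there z∈ , _ , z≢y , z-in) with cover z∈
    ...   | here z≡y = ⊥-elim (z≢y z≡y)
    ...   | there z∈ys = trans (unusable P) (sym (unusable P′))
      where
      unusable : ∀ Q → countStartingWith f Q x y ys ≡ 0
      unusable Q = if-zero (Q (x , y)) (countMatchings-isolated f ys _ z∈ys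
        (λ w → trans (cong (λ b → Q (z , w) ∧ not b) (proj₁ (inside-meetsʳ (x , y) z w z-in))) (∧-zeroʳ _))
        (λ w → trans (cong (λ b → Q (w , z) ∧ not b) (proj₂ (inside-meetsʳ (x , y) z w z-in))) (∧-zeroʳ _)))
    term y ys (y∈ , cover , sub) | inj₂ hollow rewrite agree (here refl) (there y∈) hollow =
      cong (λ n → if P′ (x , y) then n else 0) (countMatchings-cong f ys agree′)
      where
      agree′ : ∀ {u v} → u ∈ ys → v ∈ ys → Hollow ys (u , v) →
        P (u , v) ∧ not (meets (x , y) (u , v)) ≡ P′ (u , v) ∧ not (meets (x , y) (u , v))
      agree′ {u} {v} u∈ v∈ hollowᵘᵛ with pointInside? (u , v) (x ∷ xs)
      ... | inj₂ hollow′ = cong (_∧ _) (agree (there (sub u∈)) (there (sub v∈)) hollow′)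
      ... | inj₁ (z , here refl , _ , _ , z-in)
        rewrite proj₁ (inside-meetsˡ (u , v) x y z-in) = trans (∧-zeroʳ _) (sym (∧-zeroʳ _))
      ... | inj₁ (z , there z∈ , z≢u , z≢v , z-in) with cover z∈
      ...   | here refl rewrite proj₂ (inside-meetsˡ (u , v) y x z-in) = trans (∧-zeroʳ _) (sym (∧-zeroʳ _))
      ...   | there z∈ys with trans (sym z-in) (hollowᵘᵛ z∈ys z≢u z≢v)
      ...     | ()

  ≤ᵇ-true : ∀ {m n} → m ≤ n → (m ≤ᵇ n) ≡ true
  ≤ᵇ-true {m} {n} m≤n with m ≤ᵇ n | ℕ.≤⇒≤ᵇ m≤n
  ... | true | _ = refl

  ≤ᵇ-true⁻¹ : ∀ {m n} → (m ≤ᵇ n) ≡ true → m ≤ n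
  ≤ᵇ-true⁻¹ {m} {n} e = ℕ.≤ᵇ⇒≤ m n (subst T (sym e) _)

  ≤ᵇ-false : ∀ {m n} → n < m → (m ≤ᵇ n) ≡ false
  ≤ᵇ-false {m} {n} n<m with m ≤ᵇ n in eq
  ... | false = refl
  ... | true = ⊥-elim (ℕ.<⇒≱ n<m (≤ᵇ-true⁻¹ eq))

  ≤ᵇ-false⁻¹ : ∀ {m n} → (m ≤ᵇ n) ≡ false → n < m
  ≤ᵇ-false⁻¹ {m} {n} e with ℕ.≤-<-connex m n
  ... | inj₂ n<m = n<m
  ... | inj₁ m≤n with trans (sym (≤ᵇ-true m≤n)) e
  ...   | ()

  between-above : ∀ {a b j} → a < j → b < j → between a b j ≡ false
  between-above {a} {b} {j} a<j b<j rewrite ≤ᵇ-false {j} {b} b<j | ≤ᵇ-false {j} {a} a<j =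
    cong₂ _∨_ (∧-zeroʳ (a ≤ᵇ j)) (∧-zeroʳ (b ≤ᵇ j))

  between-below : ∀ {a b j} → j < a → j < b → between a b j ≡ false
  between-below {a} {b} {j} j<a j<b rewrite ≤ᵇ-false {a} {j} j<a | ≤ᵇ-false {b} {j} j<b = refl

  adjacent : ℕ → ℕ → Bool
  adjacent a b = (a ≤ᵇ suc b) ∧ (b ≤ᵇ suc a)

  adjacent-suc : ∀ i → adjacent i (suc i) ≡ true
  adjacent-suc i rewrite ≤ᵇ-true (ℕ.m≤n+m i 2) | ≤ᵇ-true (ℕ.≤-refl {suc i}) = refl

  ∧-true⁻¹ : ∀ {a b} → a ∧ b ≡ true → a ≡ true × b ≡ true
  ∧-true⁻¹ {true} {true} _ = refl , refl

  adjacent-between : ∀ {v v′ w} → v ≢ w → v′ ≢ w → adjacent v v′ ≡ true → between v v′ w ≡ false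
  adjacent-between v≢w v′≢w adj with ∧-true⁻¹ adj
  ... | v≤ , v′≤ = cong₂ _∨_ (squeeze v≢w v′≢w (≤ᵇ-true⁻¹ v′≤)) (squeeze v′≢w v≢w (≤ᵇ-true⁻¹ v≤))
    where
    squeeze : ∀ {v v′ w} → v ≢ w → v′ ≢ w → v′ ≤ suc v → (v ≤ᵇ w) ∧ (w ≤ᵇ v′) ≡ false
    squeeze {v} {v′} {w} v≢w v′≢w v′≤1+v with v ≤ᵇ w in v≤w | w ≤ᵇ v′ in w≤v′
    ... | false | _ = refl
    ... | true | false = refl
    ... | true | true with ℕ.m≤n⇒m<n∨m≡n (≤ᵇ-true⁻¹ v≤w)
    ...   | inj₂ v≡w = ⊥-elim (v≢w v≡w)
    ...   | inj₁ v<w = ⊥-elim (v′≢w (ℕ.≤-antisym (ℕ.≤-trans v′≤1+v v<w) (≤ᵇ-true⁻¹ w≤v′)))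

  interval : ℕ → ℕ → List ℕ
  interval i zero = []
  interval i (suc n) = i ∷ interval (suc i) n

  pointsFrom : Bool → ℕ → ℕ → List Point
  pointsFrom l i n = map (l ,_) (interval i n)

  lower : List ℕ → List Point
  lower B = map (false ,_) B

  allowedFrom : ℕ → Seg → Bool
  allowedFrom h ((true , a) , (true , b)) = adjacent a b
  allowedFrom h ((false , a) , (false , b)) = adjacent a b
  allowedFrom h ((true , _) , (false , b)) = h ≤ᵇ b
  allowedFrom h ((false , a) , (true , _)) = h ≤ᵇ a

  tilingsOf : List ℕ → ℕ
  tilingsOf [] = 1
  tilingsOf (c ∷ []) = 0
  tilingsOf (c ∷ d ∷ B) = if d ≤ᵇ suc c then tilingsOf B else 0

  ∈-interval⁻ : ∀ {c} i n → c ∈ interval i n → i ≤ c × c < i + n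
  ∈-interval⁻ i (suc n) (here refl) = ℕ.≤-refl , ℕ.m<m+n i (s≤s z≤n)
  ∈-interval⁻ {c} i (suc n) (there c∈) with ∈-interval⁻ (suc i) n c∈
  ... | i<c , c<i+n = ℕ.<⇒≤ i<c , subst (c <_) (sym (ℕ.+-suc i n)) c<i+n

  ∈-interval⁺ : ∀ {c} i n → i ≤ c → c < i + n → c ∈ interval i n
  ∈-interval⁺ {c} i zero i≤c c<i+0 = ⊥-elim (ℕ.<⇒≱ c<i+0 (subst (_≤ c) (sym (ℕ.+-identityʳ i)) i≤c))
  ∈-interval⁺ {c} i (suc n) i≤c c<i+n with ℕ.m≤n⇒m<n∨m≡n i≤c
  ... | inj₂ refl = here refl
  ... | inj₁ i<c = there (∈-interval⁺ (suc i) n i<c (subst (c <_) (ℕ.+-suc i n) c<i+n))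

  ∈-lower⁻ : ∀ {x} B → x ∈ lower B → Σ ℕ λ c → x ≡ (false , c) × c ∈ B
  ∈-lower⁻ B x∈ with ∈-map⁻ (false ,_) x∈
  ... | c , c∈ , refl = c , refl , c∈

  ∈-pointsFrom⁻ : ∀ {x} l i n → x ∈ pointsFrom l i n → Σ ℕ λ c → x ≡ (l , c) × i ≤ c × c < i + n
  ∈-pointsFrom⁻ l i n x∈ with ∈-map⁻ (l ,_) x∈
  ... | c , c∈ , refl = c , refl , ∈-interval⁻ i n c∈

  length-interval : ∀ i n → length (interval i n) ≡ n
  length-interval i zero = refl
  length-interval i (suc n) = cong suc (length-interval (suc i) n)

  length-pointsFrom : ∀ l i n → length (pointsFrom l i n) ≡ n
  length-pointsFrom l i n = trans (List.length-map (l ,_) (interval i n)) (length-interval i n)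

  interval-sorted : ∀ i n → AllPairs _<_ (interval i n)
  interval-sorted i zero = []
  interval-sorted i (suc n) = All.tabulate (λ c∈ → proj₁ (∈-interval⁻ (suc i) n c∈)) ∷ interval-sorted (suc i) n

  interval-suc : ∀ h d → interval h (suc d) ≡ interval h d ++ (h + d ∷ [])
  interval-suc h zero = cong (_∷ []) (sym (ℕ.+-identityʳ h))
  interval-suc h (suc d) = cong (h ∷_) (trans (interval-suc (suc h) d) (cong (λ z → interval (suc h) d ++ (z ∷ [])) (sym (ℕ.+-suc h d))))

  tilingsOf-interval : ∀ h n → tilingsOf (interval h n) ≡ tilings n
  tilingsOf-interval h zero = refl
  tilingsOf-interval h (suc zero) = refl
  tilingsOf-interval h (suc (suc n)) rewrite ≤ᵇ-true (ℕ.≤-refl {suc h}) = tilingsOf-interval (suc (suc h)) n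

  tilingsOf-++ : ∀ h xs ys → All (λ c → suc c < h) xs → All (h ≤_) ys → tilingsOf (xs ++ ys) ≡ tilingsOf xs * tilingsOf ys
  tilingsOf-++ h [] ys _ _ = sym (ℕ.+-identityʳ (tilingsOf ys))
  tilingsOf-++ h (c ∷ []) [] _ _ = refl
  tilingsOf-++ h (c ∷ []) (e ∷ ys) (c<h ∷ _) (h≤e ∷ _) rewrite ≤ᵇ-false {e} {suc c} (ℕ.<-≤-trans c<h h≤e) = refl
  tilingsOf-++ h (c ∷ d ∷ xs) ys (_ ∷ _ ∷ xs<h) h≤ys with d ≤ᵇ suc c
  ... | true = tilingsOf-++ h xs ys xs<h h≤ys
  ... | false = refl

  tilingsOf-++-interval : ∀ {h} B n → All (λ c → suc c < h) B → tilingsOf (B ++ interval h n) ≡ tilingsOf B * tilings n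
  tilingsOf-++-interval {h} B n B<h = trans (tilingsOf-++ h B (interval h n) B<h (All.tabulate (λ c∈ → proj₁ (∈-interval⁻ h n c∈))))
                                            (cong (tilingsOf B *_) (tilingsOf-interval h n))

  ++-interval-sorted : ∀ {h} B n → AllPairs _<_ B → All (λ c → suc c < h) B → AllPairs _<_ (B ++ interval h n)
  ++-interval-sorted {h} B n sorted B<h = AllPairs.++⁺ sorted (interval-sorted h n)
    (All.map (λ c<h → All.tabulate (λ e∈ → ℕ.<-≤-trans (ℕ.<-trans (ℕ.n<1+n _) c<h) (proj₁ (∈-interval⁻ h n e∈)))) B<h)

  ++-interval-below : ∀ {h} B d → All (λ c → suc c < h) B → All (_< h + d) (B ++ interval h d)
  ++-interval-below {h} B d B<h = All.++⁺ (All.map (λ c<h → ℕ.<-trans (ℕ.n<1+n _) (ℕ.<-≤-trans c<h (ℕ.m≤m+n h d))) B<h)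
                                          (All.tabulate (λ c∈ → proj₂ (∈-interval⁻ h d c∈)))

  allowed-after-lowerPair : ∀ h {c d e e′} → c < e → d < e → c < e′ → d < e′ →
    let t = ((false , e) , (false , e′)) in allowedFrom h t ∧ not (meets ((false , c) , (false , d)) t) ≡ allowedFrom h t
  allowed-after-lowerPair h {c} {d} {e} {e′} c<e d<e c<e′ d<e′
    rewrite between-above {c} {d} {e} c<e d<e | between-above {c} {d} {e′} c<e′ d<e′
          | between-below {e} {e′} {c} c<e c<e′ | between-below {e} {e′} {d} d<e d<e′ = ∧-identityʳ _

  countMatchings-lower : ∀ f h B → AllPairs _<_ B → length B ≤ f → countMatchings f (lower B) (allowedFrom h) ≡ tilingsOf B
  countMatchings-lower f h [] _ _ = refl
  countMatchings-lower zero h (c ∷ B) _ ()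
  countMatchings-lower (suc f) h (c ∷ []) _ _ = refl
  countMatchings-lower (suc f) h (c ∷ d ∷ B) ((c<d ∷ _) ∷ d<B ∷ sorted) (s≤s len) =
    trans (cong₂ _+_ pairedWith-d (sumPicks-zero (lower B) pairedBeyond-d)) (ℕ.+-identityʳ _)
    where
    beyond : ∀ {x} → x ∈ lower B → Σ ℕ λ e → x ≡ (false , e) × c < e × d < e
    beyond x∈ with ∈-lower⁻ B x∈
    ... | e , refl , e∈ = e , refl , ℕ.<-trans c<d (All.lookup d<B e∈) , All.lookup d<B e∈
    pairedWith-d : (if allowedFrom h ((false , c) , (false , d))
                    then countMatchings f (lower B) (λ t → allowedFrom h t ∧ not (meets ((false , c) , (false , d)) t))
                    else 0) ≡ tilingsOf (c ∷ d ∷ B)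
    pairedWith-d rewrite ≤ᵇ-true {c} {suc d} (ℕ.≤-trans (ℕ.<⇒≤ c<d) (ℕ.n≤1+n d)) with d ≤ᵇ suc c
    ... | false = refl
    ... | true = trans (countMatchings-cong f (lower B) after-cd) (countMatchings-lower f h B sorted (ℕ.≤-trans (ℕ.n≤1+n _) len))
      where
      after-cd : ∀ {x y} → x ∈ lower B → y ∈ lower B → _ → _
      after-cd x∈ y∈ _ with beyond x∈ | beyond y∈
      ... | e , refl , c<e , d<e | e′ , refl , c<e′ , d<e′ = allowed-after-lowerPair h c<e d<e c<e′ d<e′
    pairedBeyond-d : ∀ y ys → Pick (lower B) y ys → _ ≡ 0
    pairedBeyond-d y ys (y∈ , _) with beyond y∈
    ... | e , refl , c<e , d<e =
      if-false (trans (cong ((c ≤ᵇ suc e) ∧_) (≤ᵇ-false {e} {suc c} (ℕ.<-≤-trans (s≤s c<d) d<e))) (∧-zeroʳ _))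

  Remaining : ℕ → (ℕ → Set) → Point → Set
  Remaining u Q p = (Σ ℕ λ a → p ≡ (true , a) × u < a) ⊎ (Σ ℕ λ b → p ≡ (false , b) × Q b)

  allowed-after-upperPair : ∀ h i {x y} → Remaining (suc i) (λ _ → ⊤) x → Remaining (suc i) (λ _ → ⊤) y →
    allowedFrom h (x , y) ∧ not (meets ((true , i) , (true , suc i)) (x , y)) ≡ allowedFrom h (x , y)
  allowed-after-upperPair h i (inj₁ (a , refl , i<a)) (inj₁ (a′ , refl , i<a′))
    rewrite between-above {i} {suc i} {a} (ℕ.<-trans (ℕ.n<1+n i) i<a) i<a
          | between-above {i} {suc i} {a′} (ℕ.<-trans (ℕ.n<1+n i) i<a′) i<a′
          | between-below {a} {a′} {i} (ℕ.<-trans (ℕ.n<1+n i) i<a) (ℕ.<-trans (ℕ.n<1+n i) i<a′)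
          | between-below {a} {a′} {suc i} i<a i<a′ = ∧-identityʳ _
  allowed-after-upperPair h i (inj₁ (a , refl , i<a)) (inj₂ (b , refl , _))
    rewrite between-above {i} {suc i} {a} (ℕ.<-trans (ℕ.n<1+n i) i<a) i<a = ∧-identityʳ _
  allowed-after-upperPair h i (inj₂ (b , refl , _)) (inj₁ (a , refl , i<a))
    rewrite between-above {i} {suc i} {a} (ℕ.<-trans (ℕ.n<1+n i) i<a) i<a = ∧-identityʳ _
  allowed-after-upperPair h i (inj₂ (b , refl , _)) (inj₂ (b′ , refl , _)) = ∧-identityʳ _

  crossing-right-of : ∀ {h} w b → h ≤ w → (h ≤ᵇ b) ∧ not ((b ≤ᵇ w) ∨ false) ≡ (suc w ≤ᵇ b)
  crossing-right-of w b h≤w with ℕ.≤-<-connex b w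
  ... | inj₁ b≤w rewrite ≤ᵇ-true b≤w | ≤ᵇ-false {suc w} {b} (s≤s b≤w) = ∧-zeroʳ _
  ... | inj₂ w<b rewrite ≤ᵇ-false {b} {w} w<b | ≤ᵇ-true (ℕ.≤-trans h≤w (ℕ.<⇒≤ w<b)) | ≤ᵇ-true w<b = refl

  -- A later crossing segment avoids (i , w) iff it ends right of w; a lower neighbour pair avoiding w avoids it too.
  allowed-after-crossing : ∀ {h} i w {x y} → h ≤ w → Remaining i (_≢ w) x → Remaining i (_≢ w) y →
    allowedFrom h (x , y) ∧ not (meets ((true , i) , (false , w)) (x , y)) ≡ allowedFrom (suc w) (x , y)
  allowed-after-crossing i w h≤w (inj₁ (a , refl , i<a)) (inj₁ (a′ , refl , i<a′))
    rewrite between-below {a} {a′} {i} i<a i<a′ = ∧-identityʳ _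
  allowed-after-crossing i w h≤w (inj₁ (a , refl , i<a)) (inj₂ (b , refl , _))
    rewrite ≤ᵇ-true (ℕ.<⇒≤ i<a) | ≤ᵇ-false {a} {i} i<a = crossing-right-of w b h≤w
  allowed-after-crossing i w h≤w (inj₂ (b , refl , _)) (inj₁ (a , refl , i<a))
    rewrite ≤ᵇ-true (ℕ.<⇒≤ i<a) | ≤ᵇ-false {a} {i} i<a = crossing-right-of w b h≤w
  allowed-after-crossing i w h≤w (inj₂ (b , refl , b≢w)) (inj₂ (b′ , refl , b′≢w)) with adjacent b b′ in adj
  ... | false = refl
  ... | true rewrite adjacent-between {b} {b′} {w} b≢w b′≢w adj = refl

  lower-++-interval-∷ : ∀ B h d r → lower (B ++ interval h d) ++ ((false , h + d) ∷ r) ≡ lower (B ++ interval h (suc d)) ++ r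
  lower-++-interval-∷ B h d r = sym (begin
    lower (B ++ interval h (suc d)) ++ r              ≡⟨ cong (λ I → lower (B ++ I) ++ r) (interval-suc h d) ⟩
    lower (B ++ (interval h d ++ h + d ∷ [])) ++ r    ≡⟨ cong (λ C → lower C ++ r) (sym (List.++-assoc B (interval h d) _)) ⟩
    lower ((B ++ interval h d) ++ h + d ∷ []) ++ r    ≡⟨ cong (_++ r) (List.map-++ (false ,_) (B ++ interval h d) _) ⟩
    (lower (B ++ interval h d) ++ (false , h + d) ∷ []) ++ r ≡⟨ List.++-assoc (lower (B ++ interval h d)) _ r ⟩
    lower (B ++ interval h d) ++ ((false , h + d) ∷ r) ∎)
    where open ≡-Reasoning

  joined : (ℕ → ℕ) → ℕ → ℕ → ℕ
  joined F d zero = 0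
  joined F d (suc n) = tilings d * F n + joined F (suc d) n

  joined-2+ : ∀ F d n → joined F (suc (suc d)) n ≡ joined F d n
  joined-2+ F d zero = refl
  joined-2+ F d (suc n) = cong (tilings d * F n +_) (joined-2+ F (suc d) n)

  sumEveryOther≡joined : ∀ F n → sumEveryOther F n ≡ joined F 0 n
  sumEveryOther≡joined F zero = refl
  sumEveryOther≡joined F (suc zero) = sym (trans (ℕ.+-identityʳ _) (ℕ.+-identityʳ _))
  sumEveryOther≡joined F (suc (suc n)) =
    cong₂ _+_ (sym (ℕ.+-identityʳ _)) (trans (sumEveryOther≡joined F n) (sym (joined-2+ F 0 n)))

  upperPaired : ℕ → ℕ → ℕ
  upperPaired zero n = 0
  upperPaired (suc m) n = matchings m n

  matchings-suc : ∀ m n → matchings (suc m) n ≡ upperPaired m n + sumEveryOther (matchings m) n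
  matchings-suc zero n = refl
  matchings-suc (suc m) n = refl

  configuration : ℕ → ℕ → List ℕ → ℕ → ℕ → List Point
  configuration i m B h n = pointsFrom true i m ++ (lower B ++ pointsFrom false h n)

  -- The lower points B were passed over by crossing segments, so they can only be tiled among themselves.
  countMatchings-configuration : ∀ m f i h n B → AllPairs _<_ B → All (λ c → suc c < h) B → m + (length B + n) ≤ f →
    countMatchings f (configuration i m B h n) (allowedFrom h) ≡ tilingsOf B * matchings m n

  countMatchings-upperPair : ∀ m f i h n B → AllPairs _<_ B → All (λ c → suc c < h) B → m + (length B + n) ≤ f →
    sumPicks (λ y r → countStartingWith f (allowedFrom h) (true , i) y (r ++ (lower B ++ pointsFrom false h n)))
             (pointsFrom true (suc i) m)
      ≡ tilingsOf B * upperPaired m n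

  countMatchings-crossing : ∀ m f i h B d k → AllPairs _<_ B → All (λ c → suc c < h) B → m + (length B + (d + k)) ≤ f →
    sumPicks (λ y r → countStartingWith f (allowedFrom h) (true , i) y
                        (pointsFrom true (suc i) m ++ (lower (B ++ interval h d) ++ r)))
             (pointsFrom false (h + d) k)
      ≡ tilingsOf B * joined (matchings m) d k

  countMatchings-configuration zero f i h n B sorted B<h len = begin
    countMatchings f (lower B ++ lower (interval h n)) (allowedFrom h)
      ≡⟨ cong (λ L → countMatchings f L (allowedFrom h)) (sym (List.map-++ (false ,_) B (interval h n))) ⟩
    countMatchings f (lower (B ++ interval h n)) (allowedFrom h)
      ≡⟨ countMatchings-lower f h (B ++ interval h n) (++-interval-sorted B n sorted B<h) len′ ⟩
    tilingsOf (B ++ interval h n)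
      ≡⟨ tilingsOf-++-interval B n B<h ⟩
    tilingsOf B * tilings n ∎
    where
    open ≡-Reasoning
    len′ : length (B ++ interval h n) ≤ f
    len′ rewrite List.length-++ B {interval h n} | length-interval h n = len
  countMatchings-configuration (suc m) zero i h n B sorted B<h ()
  countMatchings-configuration (suc m) (suc f) i h n B sorted B<h (s≤s len) = begin
    sumPicks g (pointsFrom true (suc i) m ++ (lower B ++ pointsFrom false h n))
      ≡⟨ sumPicks-++ g (pointsFrom true (suc i) m) _ ⟩
    sumPicks (λ y r → g y (r ++ (lower B ++ pointsFrom false h n))) (pointsFrom true (suc i) m)
      + sumPicks (λ y r → g y (pointsFrom true (suc i) m ++ r)) (lower B ++ pointsFrom false h n)
      ≡⟨ cong₂ _+_ (countMatchings-upperPair m f i h n B sorted B<h len) crossings ⟩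
    tilingsOf B * upperPaired m n + tilingsOf B * sumEveryOther (matchings m) n
      ≡⟨ sym (ℕ.*-distribˡ-+ (tilingsOf B) _ _) ⟩
    tilingsOf B * (upperPaired m n + sumEveryOther (matchings m) n)
      ≡⟨ cong (tilingsOf B *_) (sym (matchings-suc m n)) ⟩
    tilingsOf B * matchings (suc m) n ∎
    where
    open ≡-Reasoning
    g = countStartingWith f (allowedFrom h) (true , i)
    crossings : sumPicks (λ y r → g y (pointsFrom true (suc i) m ++ r)) (lower B ++ pointsFrom false h n)
                ≡ tilingsOf B * sumEveryOther (matchings m) n
    crossings = begin
      _ ≡⟨ sumPicks-++ _ (lower B) (pointsFrom false h n) ⟩
      _ ≡⟨ cong₂ _+_ (sumPicks-zero (lower B) passedOver) refl ⟩
      sumPicks (λ y r → g y (pointsFrom true (suc i) m ++ (lower B ++ r))) (pointsFrom false h n)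
        ≡⟨ cong (λ z → sumPicks (λ y r → g y (pointsFrom true (suc i) m ++ (lower B ++ r))) (pointsFrom false z n))
                (sym (ℕ.+-identityʳ h)) ⟩
      sumPicks (λ y r → g y (pointsFrom true (suc i) m ++ (lower B ++ r))) (pointsFrom false (h + 0) n)
        ≡⟨ sumPicks-cong (λ y r → cong (λ B′ → g y (pointsFrom true (suc i) m ++ (lower B′ ++ r))) (sym (List.++-identityʳ B)))
                         (pointsFrom false (h + 0) n) ⟩
      _ ≡⟨ countMatchings-crossing m f i h B 0 n sorted B<h len ⟩
      tilingsOf B * joined (matchings m) 0 n
        ≡⟨ cong (tilingsOf B *_) (sym (sumEveryOther≡joined (matchings m) n)) ⟩
      tilingsOf B * sumEveryOther (matchings m) n ∎
      where
      passedOver : ∀ y ys → Pick (lower B) y ys → _ ≡ 0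
      passedOver y ys (y∈ , _) with ∈-lower⁻ B y∈
      ... | c , refl , c∈ = if-false (≤ᵇ-false {h} {c} (ℕ.<-trans (ℕ.n<1+n c) (All.lookup B<h c∈)))

  countMatchings-upperPair zero f i h n B sorted B<h len = sym (ℕ.*-zeroʳ (tilingsOf B))
  countMatchings-upperPair (suc k) f i h n B sorted B<h len =
    trans (cong₂ _+_ withNeighbour (sumPicks-zero (pointsFrom true (suc (suc i)) k) beyondNeighbour)) (ℕ.+-identityʳ _)
    where
    rest = pointsFrom true (suc (suc i)) k ++ (lower B ++ pointsFrom false h n)
    remaining : ∀ {x} → x ∈ rest → Remaining (suc i) (λ _ → ⊤) x
    remaining x∈ with ∈-++⁻ (pointsFrom true (suc (suc i)) k) x∈
    ... | inj₁ x∈ᵘ with ∈-pointsFrom⁻ true (suc (suc i)) k x∈ᵘ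
    ...   | a , refl , i<a , _ = inj₁ (a , refl , i<a)
    remaining x∈ | inj₂ x∈ˡ with ∈-++⁻ (lower B) x∈ˡ
    ...   | inj₁ x∈B with ∈-lower⁻ B x∈B
    ...     | b , refl , _ = inj₂ (b , refl , _)
    remaining x∈ | inj₂ x∈ˡ | inj₂ x∈ᵖ with ∈-pointsFrom⁻ false h n x∈ᵖ
    ...     | b , refl , _ = inj₂ (b , refl , _)
    withNeighbour : countStartingWith f (allowedFrom h) (true , i) (true , suc i) rest ≡ tilingsOf B * matchings k n
    withNeighbour rewrite adjacent-suc i =
      trans (countMatchings-cong f rest (λ x∈ y∈ _ → allowed-after-upperPair h i (remaining x∈) (remaining y∈)))
            (countMatchings-configuration k f (suc (suc i)) h n B sorted B<h (ℕ.≤-trans (ℕ.n≤1+n _) len))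
    beyondNeighbour : ∀ y ys → Pick (pointsFrom true (suc (suc i)) k) y ys → _ ≡ 0
    beyondNeighbour y ys (y∈ , _) with ∈-pointsFrom⁻ true (suc (suc i)) k y∈
    ... | a , refl , i<a , _ = if-false (trans (cong ((i ≤ᵇ suc a) ∧_) (≤ᵇ-false {a} {suc i} i<a)) (∧-zeroʳ _))

  countMatchings-crossing m f i h B d zero sorted B<h len = sym (ℕ.*-zeroʳ (tilingsOf B))
  countMatchings-crossing m f i h B d (suc k) sorted B<h len =
    trans (cong₂ _+_ withW laterW) (distrib (tilingsOf B) (tilings d) (matchings m k) _)
    where
    w = h + d
    B′ = B ++ interval h d
    upper = pointsFrom true (suc i) m
    rest = upper ++ (lower B′ ++ pointsFrom false (suc w) k)
    distrib : ∀ t e g s → t * e * g + t * s ≡ t * (e * g + s)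
    distrib = solve-∀
    B′<w : All (_< w) B′
    B′<w = ++-interval-below B d B<h
    remaining : ∀ {x} → x ∈ rest → Remaining i (_≢ w) x
    remaining x∈ with ∈-++⁻ upper x∈
    ... | inj₁ x∈ᵘ with ∈-pointsFrom⁻ true (suc i) m x∈ᵘ
    ...   | a , refl , i<a , _ = inj₁ (a , refl , i<a)
    remaining x∈ | inj₂ x∈ˡ with ∈-++⁻ (lower B′) x∈ˡ
    ...   | inj₁ x∈B with ∈-lower⁻ B′ x∈B
    ...     | b , refl , b∈ = inj₂ (b , refl , ℕ.<⇒≢ (All.lookup B′<w b∈))
    remaining x∈ | inj₂ x∈ˡ | inj₂ x∈ᵖ with ∈-pointsFrom⁻ false (suc w) k x∈ᵖ
    ...     | b , refl , w<b , _ = inj₂ (b , refl , λ b≡w → ℕ.<⇒≢ w<b (sym b≡w))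
    len′ : m + (length B′ + k) ≤ f
    len′ rewrite List.length-++ B {interval h d} | length-interval h d =
      ℕ.≤-trans (ℕ.≤-reflexive (reassoc m (length B) d k))
                (ℕ.≤-trans (ℕ.+-monoʳ-≤ m (ℕ.+-monoʳ-≤ (length B) (ℕ.+-monoʳ-≤ d (ℕ.n≤1+n k)))) len)
      where
      reassoc : ∀ m b d k → m + ((b + d) + k) ≡ m + (b + (d + k))
      reassoc = solve-∀
    withW : countStartingWith f (allowedFrom h) (true , i) (false , w) rest ≡ tilingsOf B * tilings d * matchings m k
    withW rewrite ≤ᵇ-true (ℕ.m≤m+n h d) = begin
      countMatchings f rest _
        ≡⟨ countMatchings-cong f rest (λ x∈ y∈ _ → allowed-after-crossing i w (ℕ.m≤m+n h d) (remaining x∈) (remaining y∈)) ⟩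
      countMatchings f rest (allowedFrom (suc w))
        ≡⟨ countMatchings-configuration m f (suc i) (suc w) k B′ (++-interval-sorted B d sorted B<h) (All.map s≤s B′<w) len′ ⟩
      tilingsOf B′ * matchings m k
        ≡⟨ cong (_* matchings m k) (tilingsOf-++-interval B d B<h) ⟩
      tilingsOf B * tilings d * matchings m k ∎
      where open ≡-Reasoning
    laterW : sumPicks (λ y r → countStartingWith f (allowedFrom h) (true , i) y (upper ++ (lower B′ ++ ((false , w) ∷ r))))
                      (pointsFrom false (suc w) k)
             ≡ tilingsOf B * joined (matchings m) (suc d) k
    laterW = trans (sumPicks-cong (λ y r → cong (λ z → countStartingWith f (allowedFrom h) (true , i) y (upper ++ z)) (lower-++-interval-∷ B h d r))
                                  (pointsFrom false (suc w) k))
      (trans (cong (λ z → sumPicks (λ y r → countStartingWith f (allowedFrom h) (true , i) y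
                                      (upper ++ (lower (B ++ interval h (suc d)) ++ r))) (pointsFrom false z k))
                   (sym (ℕ.+-suc h d)))
             (countMatchings-crossing m f i h B (suc d) k sorted B<h (subst (λ z → m + (length B + z) ≤ f) (ℕ.+-suc d k) len)))

  applyUpTo≡interval : ∀ k i (f : ℕ → ℕ) → (∀ j → f j ≡ i + j) → applyUpTo f k ≡ interval i k
  applyUpTo≡interval zero i f e = refl
  applyUpTo≡interval (suc k) i f e = cong₂ _∷_ (trans (e 0) (ℕ.+-identityʳ i))
    (applyUpTo≡interval k (suc i) (λ j → f (suc j)) (λ j → trans (e (suc j)) (ℕ.+-suc i j)))

  points≡configuration : ∀ p q → points p q ≡ configuration 0 p [] 0 q
  points≡configuration p q = cong₂ (λ I J → map (true ,_) I ++ map (false ,_) J)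
    (applyUpTo≡interval p 0 (λ j → j) (λ _ → refl)) (applyUpTo≡interval q 0 (λ j → j) (λ _ → refl))

  inside-line : ∀ l a b c → inside ((l , a) , (l , b)) (l , c) ≡ between a b c
  inside-line true a b c = refl
  inside-line false a b c = refl

  hollow-between : ∀ {l a b c L} → Hollow L ((l , a) , (l , b)) → (l , c) ∈ L → c ≢ a → c ≢ b → between a b c ≢ true
  hollow-between {l} {a} {b} {c} hollow c∈ c≢a c≢b on
    with trans (sym on) (trans (sym (inside-line l a b c)) (hollow c∈ (λ e → c≢a (cong proj₂ e)) (λ e → c≢b (cong proj₂ e))))
  ... | ()

  hollow⇒adjacent : ∀ {l a b k L} → a < k → b < k → (∀ {c} → c < k → (l , c) ∈ L) → Hollow L ((l , a) , (l , b)) →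
    adjacent a b ≡ true
  hollow⇒adjacent {l} {a} {b} a<k b<k on-line hollow with a ≤ᵇ suc b in a≤ | b ≤ᵇ suc a in b≤
  ... | true | true = refl
  ... | false | _ = let b+1<a = ≤ᵇ-false⁻¹ a≤ in
    ⊥-elim (hollow-between hollow (on-line (ℕ.<-trans b+1<a a<k)) (ℕ.<⇒≢ b+1<a) ℕ.1+n≢n
      (∨-true _ (cong₂ _∧_ (≤ᵇ-true (ℕ.n≤1+n b)) (≤ᵇ-true (ℕ.<⇒≤ b+1<a)))))
  ... | true | false = let a+1<b = ≤ᵇ-false⁻¹ b≤ in
    ⊥-elim (hollow-between hollow (on-line (ℕ.<-trans a+1<b b<k)) ℕ.1+n≢n (ℕ.<⇒≢ a+1<b)
      (cong (_∨ ((b ≤ᵇ suc a) ∧ (suc a ≤ᵇ a))) (cong₂ _∧_ (≤ᵇ-true (ℕ.n≤1+n a)) (≤ᵇ-true (ℕ.<⇒≤ a+1<b)))))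

  countMatchings-initial : ∀ p q f → countMatchings f (configuration 0 p [] 0 q) (λ _ → true)
                                   ≡ countMatchings f (configuration 0 p [] 0 q) (allowedFrom 0)
  countMatchings-initial p q f = countMatchings-cong f L allowed
    where
    L = configuration 0 p [] 0 q
    classify : ∀ {x} → x ∈ L → (Σ ℕ λ c → x ≡ (true , c) × c < p) ⊎ (Σ ℕ λ c → x ≡ (false , c) × c < q)
    classify x∈ with ∈-++⁻ (pointsFrom true 0 p) x∈
    ... | inj₁ x∈ᵘ with ∈-pointsFrom⁻ true 0 p x∈ᵘ
    ...   | c , refl , _ , c<p = inj₁ (c , refl , c<p)
    classify x∈ | inj₂ x∈ˡ with ∈-pointsFrom⁻ false 0 q x∈ˡ
    ...   | c , refl , _ , c<q = inj₂ (c , refl , c<q)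
    on-upper : ∀ {c} → c < p → (true , c) ∈ L
    on-upper c<p = ∈-++⁺ˡ (∈-map⁺ (true ,_) (∈-interval⁺ 0 p z≤n c<p))
    on-lower : ∀ {c} → c < q → (false , c) ∈ L
    on-lower c<q = ∈-++⁺ʳ (pointsFrom true 0 p) (∈-map⁺ (false ,_) (∈-interval⁺ 0 q z≤n c<q))
    allowed : ∀ {x y} → x ∈ L → y ∈ L → Hollow L (x , y) → true ≡ allowedFrom 0 (x , y)
    allowed x∈ y∈ hollow with classify x∈ | classify y∈
    ... | inj₁ (a , refl , a<p) | inj₁ (b , refl , b<p) = sym (hollow⇒adjacent a<p b<p on-upper hollow)
    ... | inj₂ (a , refl , a<q) | inj₂ (b , refl , b<q) = sym (hollow⇒adjacent a<q b<q on-lower hollow)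
    ... | inj₁ (a , refl , _) | inj₂ (b , refl , _) = refl
    ... | inj₂ (a , refl , _) | inj₁ (b , refl , _) = refl

  a≡matchings : ∀ p q → a p q ≡ matchings p q
  a≡matchings p q = begin
    a p q
      ≡⟨ length-filter-T? disjointAll (pairings (points p q)) ⟩
    countᵇ disjointAll (pairings (points p q))
      ≡⟨ countᵇ-cong (λ M → cong (_∧ disjointAll M) (sym (all-true M))) (pairings (points p q)) ⟩
    countᵇ (admissible (λ _ → true)) (pairings (points p q))
      ≡⟨ countᵇ-pairingsF (length (points p q)) (points p q) (λ _ → true) ⟩
    countMatchings (length (points p q)) (points p q) (λ _ → true)
      ≡⟨ cong (λ L → countMatchings (length L) L (λ _ → true)) (points≡configuration p q) ⟩
    countMatchings (length L) L (λ _ → true)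
      ≡⟨ countMatchings-initial p q (length L) ⟩
    countMatchings (length L) L (allowedFrom 0)
      ≡⟨ countMatchings-configuration p (length L) 0 0 q [] [] [] (ℕ.≤-reflexive (sym length-L)) ⟩
    matchings p q + 0
      ≡⟨ ℕ.+-identityʳ (matchings p q) ⟩
    matchings p q ∎
    where
    open ≡-Reasoning
    L = configuration 0 p [] 0 q
    all-true : ∀ M → all (λ _ → true) M ≡ true
    all-true [] = refl
    all-true (_ ∷ M) = all-true M
    length-L : length L ≡ p + (0 + q)
    length-L = trans (List.length-++ (pointsFrom true 0 p)) (cong₂ _+_ (length-pointsFrom true 0 p) (length-pointsFrom false 0 q))

module Recurrence where

  open import Data.Nat as ℕ using (ℕ; zero; suc; _<_)
  import Data.Nat.Properties as ℕₚ
  open import Data.Nat.Tactic.RingSolver as ℕ-Solver using ()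
  open import Data.Integer using (ℤ; +_; -[1+_]; _+_; _-_; _*_; _≟_)
  import Data.Integer.Properties as ℤₚ
  open import Data.Integer.Tactic.RingSolver using (solve-∀)
  open import Data.Product using (_×_; _,_; proj₁; proj₂)
  open import Function.Nary.NonDependent using (congₙ)
  open import Data.Empty using (⊥-elim)
  open import Relation.Nullary using (¬_; yes; no)
  open import Relation.Binary.PropositionalEquality
  open Matchings using (tilings; sumEveryOther; matchings)

  A : ℤ → ℤ → ℤ
  A (+ m) (+ n) = + matchings m n
  A (+ m) -[1+ n ] = + 0
  A -[1+ m ] Q = + 0

  infixl 7 _⊝_

  -- P ⊝ s is P - s, arranged so that P ⊝ 0 is P itself
  _⊝_ : ℤ → ℕ → ℤ
  P ⊝ zero = P
  P ⊝ suc s = P - + suc s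

  ⊝-⊝ : ∀ P a b → P ⊝ a ⊝ b ≡ P ⊝ (b ℕ.+ a)
  ⊝-⊝ P a zero = refl
  ⊝-⊝ P zero (suc b) = cong (λ k → P - + suc k) (sym (ℕₚ.+-identityʳ b))
  ⊝-⊝ P (suc a) (suc b) = trans (ℤₚ.+-assoc P -[1+ a ] -[1+ b ])
    (cong (λ k → P + -[1+ k ]) (trans (cong suc (ℕₚ.+-comm a b)) (sym (ℕₚ.+-suc b a))))

  -- the coefficients of D · Σ f P Q xᴾ yᑫ for D = (1 - x²)(1 - y²) - xy
  L : (ℤ → ℤ → ℤ) → ℤ → ℤ → ℤ
  L f P Q = f P Q - f (P ⊝ 1) (Q ⊝ 1) - f (P ⊝ 2) Q - f P (Q ⊝ 2) + f (P ⊝ 2) (Q ⊝ 2)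

  -- the coefficients of (y∂D/∂y)(x∂F/∂x) - (x∂D/∂x)(y∂F/∂y) for F = Σ f P Q xᴾ yᑫ
  M : (ℤ → ℤ → ℤ) → ℤ → ℤ → ℤ
  M f P Q = (Q - P) * f (P ⊝ 1) (Q ⊝ 1) - + 2 * P * f P (Q ⊝ 2) + + 2 * Q * f (P ⊝ 2) Q + + 2 * (P - Q) * f (P ⊝ 2) (Q ⊝ 2)

  SupportedInQuadrant : (ℤ → ℤ → ℤ) → Set
  SupportedInQuadrant f = (∀ k Q → f -[1+ k ] Q ≡ + 0) × (∀ P k → f P -[1+ k ] ≡ + 0)

  SupportedAtOrigin : (ℤ → ℤ → ℤ) → Set
  SupportedAtOrigin g = ∀ P Q → ¬ (P ≡ + 0 × Q ≡ + 0) → g P Q ≡ + 0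

  L-⊝ : ∀ f P Q a b → L f (P ⊝ a) (Q ⊝ b) ≡
    f (P ⊝ a) (Q ⊝ b) - f (P ⊝ suc a) (Q ⊝ suc b) - f (P ⊝ suc (suc a)) (Q ⊝ b) - f (P ⊝ a) (Q ⊝ suc (suc b))
      + f (P ⊝ suc (suc a)) (Q ⊝ suc (suc b))
  L-⊝ f P Q a b = congₙ 4 (λ w x y z → f (P ⊝ a) (Q ⊝ b) - w - x - y + z)
    (cong₂ f (⊝-⊝ P a 1) (⊝-⊝ Q b 1)) (cong (λ R → f R (Q ⊝ b)) (⊝-⊝ P a 2))
    (cong (f (P ⊝ a)) (⊝-⊝ Q b 2)) (cong₂ f (⊝-⊝ P a 2) (⊝-⊝ Q b 2))

  M-⊝ : ∀ f P Q a b → M f (P ⊝ a) (Q ⊝ b) ≡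
    (Q ⊝ b - P ⊝ a) * f (P ⊝ suc a) (Q ⊝ suc b) - + 2 * (P ⊝ a) * f (P ⊝ a) (Q ⊝ suc (suc b))
      + + 2 * (Q ⊝ b) * f (P ⊝ suc (suc a)) (Q ⊝ b) + + 2 * (P ⊝ a - Q ⊝ b) * f (P ⊝ suc (suc a)) (Q ⊝ suc (suc b))
  M-⊝ f P Q a b = congₙ 4 (λ w x y z → (Q ⊝ b - P ⊝ a) * w - + 2 * (P ⊝ a) * x + + 2 * (Q ⊝ b) * y + + 2 * (P ⊝ a - Q ⊝ b) * z)
    (cong₂ f (⊝-⊝ P a 1) (⊝-⊝ Q b 1)) (cong (f (P ⊝ a)) (⊝-⊝ Q b 2))
    (cong (λ R → f R (Q ⊝ b)) (⊝-⊝ P a 2)) (cong₂ f (⊝-⊝ P a 2) (⊝-⊝ Q b 2))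

  L-M : ∀ f P Q → L (M f) P Q ≡
    (Q - P) * L f (P ⊝ 1) (Q ⊝ 1) - + 2 * P * L f P (Q ⊝ 2) + + 2 * Q * L f (P ⊝ 2) Q + + 2 * (P - Q) * L f (P ⊝ 2) (Q ⊝ 2)
  L-M f P Q =
    trans (congₙ 5 (λ v w x y z → v - w - x - y + z) (M-⊝ f P Q 0 0) (M-⊝ f P Q 1 1) (M-⊝ f P Q 2 0) (M-⊝ f P Q 0 2) (M-⊝ f P Q 2 2))
    (trans (expand P Q (F 0 2) (F 0 4) (F 1 1) (F 1 3) (F 2 0) (F 2 2) (F 2 4) (F 3 1) (F 3 3) (F 4 0) (F 4 2) (F 4 4))
    (sym (congₙ 4 (λ w x y z → (Q - P) * w - + 2 * P * x + + 2 * Q * y + + 2 * (P - Q) * z)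
      (L-⊝ f P Q 1 1) (L-⊝ f P Q 0 2) (L-⊝ f P Q 2 0) (L-⊝ f P Q 2 2))))
    where
    F : ℕ → ℕ → ℤ
    F i j = f (P ⊝ i) (Q ⊝ j)
    expand : ∀ (P Q x02 x04 x11 x13 x20 x22 x24 x31 x33 x40 x42 x44 : ℤ) →
      ((Q - P) * x11 - + 2 * P * x02 + + 2 * Q * x20 + + 2 * (P - Q) * x22)
      - (((Q - + 1) - (P - + 1)) * x22 - + 2 * (P - + 1) * x13 + + 2 * (Q - + 1) * x31 + + 2 * ((P - + 1) - (Q - + 1)) * x33)
      - ((Q - (P - + 2)) * x31 - + 2 * (P - + 2) * x22 + + 2 * Q * x40 + + 2 * ((P - + 2) - Q) * x42)
      - (((Q - + 2) - P) * x13 - + 2 * P * x04 + + 2 * (Q - + 2) * x22 + + 2 * (P - (Q - + 2)) * x24)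
      + (((Q - + 2) - (P - + 2)) * x33 - + 2 * (P - + 2) * x24 + + 2 * (Q - + 2) * x42 + + 2 * ((P - + 2) - (Q - + 2)) * x44)
      ≡ (Q - P) * (x11 - x22 - x31 - x13 + x33) - + 2 * P * (x02 - x13 - x22 - x04 + x24)
        + + 2 * Q * (x20 - x31 - x40 - x22 + x42) + + 2 * (P - Q) * (x22 - x33 - x42 - x24 + x44)
    expand = solve-∀

  annihilate : ∀ R {x} → (¬ R ≡ + 0 → x ≡ + 0) → R * x ≡ + 0
  annihilate R h with R ≟ + 0
  ... | yes refl = refl
  ... | no R≢0 = trans (cong (R *_) (h R≢0)) (ℤₚ.*-zeroʳ R)

  coordinate-annihilates : ∀ {g} → SupportedAtOrigin g → ∀ P Q → P * g P Q ≡ + 0 × Q * g P Q ≡ + 0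
  coordinate-annihilates origin P Q =
    annihilate P (λ P≢0 → origin P Q (λ (P≡0 , _) → P≢0 P≡0)) , annihilate Q (λ Q≢0 → origin P Q (λ (_ , Q≡0) → Q≢0 Q≡0))

  -- (Q - P) is split as (Q - 1) - (P - 1) so that each coefficient is a coordinate of the point where L f is taken
  L-M-vanishes : ∀ f → SupportedAtOrigin (L f) → ∀ P Q → L (M f) P Q ≡ + 0
  L-M-vanishes f origin P Q = begin
    L (M f) P Q
      ≡⟨ L-M f P Q ⟩
    (Q - P) * L f (P ⊝ 1) (Q ⊝ 1) - + 2 * P * L f P (Q ⊝ 2) + + 2 * Q * L f (P ⊝ 2) Q + + 2 * (P - Q) * L f (P ⊝ 2) (Q ⊝ 2)
      ≡⟨ regroup P Q _ _ _ _ ⟩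
    ((Q ⊝ 1) * L f (P ⊝ 1) (Q ⊝ 1) - (P ⊝ 1) * L f (P ⊝ 1) (Q ⊝ 1)) - + 2 * (P * L f P (Q ⊝ 2))
      + + 2 * (Q * L f (P ⊝ 2) Q) + + 2 * ((P ⊝ 2) * L f (P ⊝ 2) (Q ⊝ 2) - (Q ⊝ 2) * L f (P ⊝ 2) (Q ⊝ 2))
      ≡⟨ congₙ 6 (λ a b c d e g → (a - b) - + 2 * c + + 2 * d + + 2 * (e - g))
           (proj₂ (coordinate-annihilates origin (P ⊝ 1) (Q ⊝ 1))) (proj₁ (coordinate-annihilates origin (P ⊝ 1) (Q ⊝ 1)))
           (proj₁ (coordinate-annihilates origin P (Q ⊝ 2))) (proj₂ (coordinate-annihilates origin (P ⊝ 2) Q))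
           (proj₁ (coordinate-annihilates origin (P ⊝ 2) (Q ⊝ 2))) (proj₂ (coordinate-annihilates origin (P ⊝ 2) (Q ⊝ 2))) ⟩
    + 0 ∎
    where
    open ≡-Reasoning
    regroup : ∀ P Q y₁ y₂ y₃ y₄ → (Q - P) * y₁ - + 2 * P * y₂ + + 2 * Q * y₃ + + 2 * (P - Q) * y₄
      ≡ ((Q - + 1) * y₁ - (P - + 1) * y₁) - + 2 * (P * y₂) + + 2 * (Q * y₃) + + 2 * ((P - + 2) * y₄ - (Q - + 2) * y₄)
    regroup = solve-∀

  quadrant-unique : ∀ {g} → SupportedInQuadrant g → (∀ P Q → L g P Q ≡ + 0) → ∀ P Q → g P Q ≡ + 0
  quadrant-unique (negˡ , negʳ) L≡0 -[1+ k ] Q = negˡ k Q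
  quadrant-unique (negˡ , negʳ) L≡0 (+ m) -[1+ k ] = negʳ (+ m) k
  quadrant-unique {g} (negˡ , negʳ) L≡0 (+ m) (+ n) = vanish (suc (m ℕ.+ n)) m n (ℕₚ.n<1+n _)
    where
    solve-for-g : ∀ v w x y z → v - w - x - y + z ≡ + 0 → v ≡ w + x + y - z
    solve-for-g v w x y z h = trans (rearrange v w x y z) (trans (cong (_+ (w + x + y - z)) h) (ℤₚ.+-identityˡ _))
      where
      rearrange : ∀ v w x y z → v ≡ (v - w - x - y + z) + (w + x + y - z)
      rearrange = solve-∀
    <2+ : ∀ m → m < suc (suc m)
    <2+ m = ℕₚ.m<n+m m (ℕ.s≤s ℕ.z≤n)
    Below : ℕ → ℕ → Set
    Below m n = ∀ {m′ n′} → m′ ℕ.+ n′ < m ℕ.+ n → g (+ m′) (+ n′) ≡ + 0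
    at₁₁ : ∀ m n → Below m n → g (+ m ⊝ 1) (+ n ⊝ 1) ≡ + 0
    at₁₁ zero n _ = negˡ 0 _
    at₁₁ (suc m) zero _ = negʳ _ 0
    at₁₁ (suc m) (suc n) below = below (ℕₚ.+-mono-< (ℕₚ.n<1+n m) (ℕₚ.n<1+n n))
    at₂₀ : ∀ m n → Below m n → g (+ m ⊝ 2) (+ n) ≡ + 0
    at₂₀ zero n _ = negˡ 1 _
    at₂₀ (suc zero) n _ = negˡ 0 _
    at₂₀ (suc (suc m)) n below = below (ℕₚ.+-monoˡ-< n (<2+ m))
    at₀₂ : ∀ m n → Below m n → g (+ m) (+ n ⊝ 2) ≡ + 0
    at₀₂ m zero _ = negʳ _ 1
    at₀₂ m (suc zero) _ = negʳ _ 0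
    at₀₂ m (suc (suc n)) below = below (ℕₚ.+-monoʳ-< m (<2+ n))
    at₂₂ : ∀ m n → Below m n → g (+ m ⊝ 2) (+ n ⊝ 2) ≡ + 0
    at₂₂ zero n _ = negˡ 1 _
    at₂₂ (suc zero) n _ = negˡ 0 _
    at₂₂ (suc (suc m)) zero _ = negʳ _ 1
    at₂₂ (suc (suc m)) (suc zero) _ = negʳ _ 0
    at₂₂ (suc (suc m)) (suc (suc n)) below = below (ℕₚ.+-mono-< (<2+ m) (<2+ n))
    vanish : ∀ N m n → m ℕ.+ n < N → g (+ m) (+ n) ≡ + 0
    vanish (suc N) m n m+n<1+N = trans (solve-for-g _ _ _ _ _ (L≡0 (+ m) (+ n)))
      (congₙ 4 (λ w x y z → w + x + y - z) (at₁₁ m n below) (at₂₀ m n below) (at₀₂ m n below) (at₂₂ m n below))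
      where
      below : Below m n
      below lt = vanish N _ _ (ℕₚ.<-≤-trans lt (ℕₚ.≤-pred m+n<1+N))

  M-supportedInQuadrant : ∀ f → SupportedInQuadrant f → SupportedInQuadrant (M f)
  M-supportedInQuadrant f (negˡ , negʳ) =
    (λ k Q → trans (terms-vanish -[1+ k ] Q (negˡ _ _) (negˡ _ _) (negˡ _ _) (negˡ _ _)) (M-zero -[1+ k ] Q)) ,
    (λ P k → trans (terms-vanish P -[1+ k ] (negʳ _ _) (negʳ _ _) (negʳ _ _) (negʳ _ _)) (M-zero P -[1+ k ]))
    where
    terms-vanish : ∀ P Q → f (P ⊝ 1) (Q ⊝ 1) ≡ + 0 → f P (Q ⊝ 2) ≡ + 0 → f (P ⊝ 2) Q ≡ + 0 → f (P ⊝ 2) (Q ⊝ 2) ≡ + 0 →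
      M f P Q ≡ M (λ _ _ → + 0) P Q
    terms-vanish P Q = congₙ 4 (λ w x y z → (Q - P) * w - + 2 * P * x + + 2 * Q * y + + 2 * (P - Q) * z)
    M-zero : ∀ P Q → (Q - P) * + 0 - + 2 * P * + 0 + + 2 * Q * + 0 + + 2 * (P - Q) * + 0 ≡ + 0
    M-zero = solve-∀

  M-vanishes : ∀ f → SupportedInQuadrant f → SupportedAtOrigin (L f) → ∀ P Q → M f P Q ≡ + 0
  M-vanishes f quadrant origin = quadrant-unique (M-supportedInQuadrant f quadrant) (L-M-vanishes f origin)

  recurrence : (ℤ → ℤ) → ℕ → ℤ
  recurrence r n = (+ n) * r (+ n) - (+ 2 * + n - + 1) * r (+ n - + 1) - (+ n - + 1) * r (+ n - + 2)
    - (+ 2 * + n - + 3) * r (+ n - + 3) + (+ n - + 2) * r (+ n - + 4)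

  recurrence-cong : ∀ {r s} → (∀ x → r x ≡ s x) → ∀ n → recurrence r n ≡ recurrence s n
  recurrence-cong e n = congₙ 5
    (λ v w x y z → (+ n) * v - (+ 2 * + n - + 1) * w - (+ n - + 1) * x - (+ 2 * + n - + 3) * y + (+ n - + 2) * z)
    (e _) (e _) (e _) (e _) (e _)

  -- Twice the recurrence is a combination of values of M f and of values of L f, each of the latter
  -- multiplied by a coordinate of its point.
  recurrence-diagonal : ∀ f → SupportedInQuadrant f → SupportedAtOrigin (L f) → ∀ n → recurrence (λ x → f x x) n ≡ + 0
  recurrence-diagonal f quadrant origin n = ℤₚ.*-cancelˡ-≡ (+ 2) _ _ (trans doubled (sym (ℤₚ.*-zeroʳ (+ 2))))
    where
    N = + n
    F : ℕ → ℕ → ℤ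
    F i j = f (N ⊝ i) (N ⊝ j)
    combine : ℤ → ℤ → ℤ → ℤ → ℤ → ℤ → ℤ → ℤ
    combine p₁ p₂ p₃ p₄ p₅ e₁ e₂ = + 2 * p₁ + + 2 * p₂ - + 2 * p₃ + + 2 * p₄ + + 2 * p₅ - e₁ + e₂
    combination : ℤ → ℤ → ℤ → ℤ → ℤ → ℤ → ℤ → ℤ
    combination y₁ y₂ y₃ y₄ y₅ = combine (N * y₁) (N * y₂) ((N - + 1) * y₃) (N * y₄) ((N - + 2) * y₅)
    certificate : ∀ (N x00 x02 x04 x11 x13 x20 x22 x24 x31 x33 x40 x42 x44 : ℤ) →
      + 2 * (N * x00 - (+ 2 * N - + 1) * x11 - (N - + 1) * x22 - (+ 2 * N - + 3) * x33 + (N - + 2) * x44)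
      ≡ + 2 * (N * (x00 - x11 - x20 - x02 + x22)) + + 2 * (N * (x02 - x13 - x22 - x04 + x24))
        - + 2 * ((N - + 1) * (x11 - x22 - x31 - x13 + x33)) + + 2 * (N * (x20 - x31 - x40 - x22 + x42))
        + + 2 * ((N - + 2) * (x22 - x33 - x42 - x24 + x44))
        - (((N - + 2) - N) * x13 - + 2 * N * x04 + + 2 * (N - + 2) * x22 + + 2 * (N - (N - + 2)) * x24)
        + ((N - (N - + 2)) * x31 - + 2 * (N - + 2) * x22 + + 2 * N * x40 + + 2 * ((N - + 2) - N) * x42)
    certificate = solve-∀
    doubled : + 2 * recurrence (λ x → f x x) n ≡ + 0
    doubled = begin
      + 2 * recurrence (λ x → f x x) n
        ≡⟨ certificate N (F 0 0) (F 0 2) (F 0 4) (F 1 1) (F 1 3) (F 2 0) (F 2 2) (F 2 4) (F 3 1) (F 3 3) (F 4 0) (F 4 2) (F 4 4) ⟩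
      _ ≡⟨ sym (congₙ 7 combination (L-⊝ f N N 0 0) (L-⊝ f N N 0 2) (L-⊝ f N N 1 1) (L-⊝ f N N 2 0) (L-⊝ f N N 2 2)
                                    (M-⊝ f N N 0 2) (M-⊝ f N N 2 0)) ⟩
      combination (L f N N) (L f N (N ⊝ 2)) (L f (N ⊝ 1) (N ⊝ 1)) (L f (N ⊝ 2) N) (L f (N ⊝ 2) (N ⊝ 2))
                  (M f N (N ⊝ 2)) (M f (N ⊝ 2) N)
        ≡⟨ congₙ 7 combine
             (proj₁ (coordinate-annihilates origin N N)) (proj₁ (coordinate-annihilates origin N (N ⊝ 2)))
             (proj₁ (coordinate-annihilates origin (N ⊝ 1) (N ⊝ 1))) (proj₂ (coordinate-annihilates origin (N ⊝ 2) N))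
             (proj₁ (coordinate-annihilates origin (N ⊝ 2) (N ⊝ 2)))
             (M-vanishes f quadrant origin N (N ⊝ 2)) (M-vanishes f quadrant origin (N ⊝ 2) N) ⟩
      + 0 ∎
      where open ≡-Reasoning

  A-supportedInQuadrant : SupportedInQuadrant A
  A-supportedInQuadrant = (λ _ _ → refl) , λ { (+ _) _ → refl ; -[1+ _ ] _ → refl }

  difference-vanishes : ∀ x y z w e → x ℕ.+ e ≡ y ℕ.+ z ℕ.+ w → + x - + y - + z - + w + + e ≡ + 0
  difference-vanishes x y z w e balance =
    trans (regroup (+ x) (+ y) (+ z) (+ w) (+ e)) (trans (cong (λ t → + t - + (y ℕ.+ z ℕ.+ w)) balance) (ℤₚ.+-inverseʳ (+ (y ℕ.+ z ℕ.+ w))))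
    where
    regroup : ∀ x y z w e → x - y - z - w + e ≡ (x + e) - (y + z + w)
    regroup = solve-∀

  matchings-recurrence : ∀ m n → matchings (suc (suc m)) (suc (suc n)) ℕ.+ matchings m n
    ≡ matchings (suc m) (suc n) ℕ.+ matchings m (suc (suc n)) ℕ.+ matchings (suc (suc m)) n
  matchings-recurrence m n = rearrange (matchings m (suc (suc n))) (matchings (suc m) (suc n))
                                       (sumEveryOther (matchings (suc m)) n) (matchings m n)
    where
    rearrange : ∀ a b c d → (a ℕ.+ (b ℕ.+ c)) ℕ.+ d ≡ b ℕ.+ a ℕ.+ (d ℕ.+ c)
    rearrange = ℕ-Solver.solve-∀

  L-A-supportedAtOrigin : SupportedAtOrigin (L A)
  L-A-supportedAtOrigin -[1+ k ] Q _ = refl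
  L-A-supportedAtOrigin (+ 0) -[1+ k ] _ = refl
  L-A-supportedAtOrigin (+ 1) -[1+ k ] _ = refl
  L-A-supportedAtOrigin (+ suc (suc m)) -[1+ k ] _ = refl
  L-A-supportedAtOrigin (+ 0) (+ 0) not-origin = ⊥-elim (not-origin (refl , refl))
  L-A-supportedAtOrigin (+ 0) (+ 1) _ = refl
  L-A-supportedAtOrigin (+ 0) (+ suc (suc n)) _ = difference-vanishes (tilings n) 0 0 (tilings n) 0 (ℕₚ.+-identityʳ _)
  L-A-supportedAtOrigin (+ 1) (+ 0) _ = refl
  L-A-supportedAtOrigin (+ 1) (+ 1) _ = refl
  L-A-supportedAtOrigin (+ 1) (+ suc (suc n)) _ = difference-vanishes (p ℕ.+ q) p 0 q 0
    (trans (ℕₚ.+-identityʳ _) (cong (ℕ._+ q) (sym (ℕₚ.+-identityʳ p))))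
    where
    p = matchings 0 (suc n)
    q = sumEveryOther (matchings 0) n
  L-A-supportedAtOrigin (+ suc (suc m)) (+ 0) _ =
    difference-vanishes (matchings m 0 ℕ.+ 0) 0 (matchings m 0) 0 0 (ℕₚ.+-identityʳ _)
  L-A-supportedAtOrigin (+ suc (suc m)) (+ 1) _ = difference-vanishes (p ℕ.+ q) q p 0 0 (cong (ℕ._+ 0) (ℕₚ.+-comm p q))
    where
    p = matchings m 1
    q = matchings (suc m) 0
  L-A-supportedAtOrigin (+ suc (suc m)) (+ suc (suc n)) _ =
    difference-vanishes _ (matchings (suc m) (suc n)) (matchings m (suc (suc n))) (matchings (suc (suc m)) n) (matchings m n)
      (matchings-recurrence m n)

open import Data.Nat using (ℕ; _≤_)
open import Data.Integer using (ℤ; +_; -[1+_]; _+_; _-_; _*_)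
open import Relation.Binary.PropositionalEquality using (_≡_; refl; cong; trans)
open Recurrence using (A; recurrence; recurrence-cong; recurrence-diagonal; A-supportedInQuadrant; L-A-supportedAtOrigin)

r≡A : ∀ x → r x ≡ A x x
r≡A (+ n) = cong +_ (Matchings.a≡matchings n n)
r≡A -[1+ n ] = refl

mainTheorem19 : (n : ℕ) → 1 ≤ n →
    (+ n) * r (+ n) - (+ 2 * + n - + 1) * r (+ n - + 1) - (+ n - + 1) * r (+ n - + 2)
      - (+ 2 * + n - + 3) * r (+ n - + 3) + (+ n - + 2) * r (+ n - + 4) ≡ + 0
mainTheorem19 n _ = trans (recurrence-cong r≡A n) (recurrence-diagonal A A-supportedInQuadrant L-A-supportedAtOrigin n)
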